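{- Let $\Gamma$ be a cubic $1$-walk-regular graph with diameter at least two. Then $\Gamma$ is $2$-walk-regular.
   Context: All graphs are finite, simple and connected. For $t\geq0$, a graph is $t$-walk-regular if it has diameter at least $t$ and for every $\ell\geq0$ the number of walks of length $\ell$ between vertices $x$ and $y$ depends only on $\mathrm{dist}(x,y)$ whenever $\mathrm{dist}(x,y)\leq t$. Cubic means regular of valency $3$. -}

module Defs where

open import Data.Nat using (ℕ; zero; suc; _+_; _*_; _≤_; _<_)
open import Data.Fin using (Fin; zero; suc)
open import Data.Fin.Properties using (_≟_)
open import Data.Bool using (Bool; true; false; if_then_else_)
open import Data.Product using (Σ; ∃; ∃-syntax; _×_)
open import Relation.Nullary using (¬_; does)
open import Relation.Binary.PropositionalEquality using (_≡_)

ΣFin : (n : ℕ) → (Fin n → ℕ) → ℕ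
ΣFin zero    f = 0
ΣFin (suc n) f = f zero + ΣFin n (λ i → f (suc i))

record Graph : Set where
  field
    n      : ℕ
    adj    : Fin n → Fin n → Bool
    sym    : ∀ x y → adj x y ≡ adj y x
    irrefl : ∀ x → adj x x ≡ false

module _ (G : Graph) where
  open Graph G

  A : Fin n → Fin n → ℕ
  A x y = if adj x y then 1 else 0

  degree : Fin n → ℕ
  degree x = ΣFin n (A x)

  data Walk : Fin n → Fin n → ℕ → Set where
    [] : ∀ {x} → Walk x x 0
    _∷_ : ∀ {x z y ℓ} → adj x z ≡ true → Walk z y ℓ → Walk x y (suc ℓ)

  numWalks : ℕ → Fin n → Fin n → ℕ
  numWalks zero    x y = if does (x ≟ y) then 1 else 0
  numWalks (suc ℓ) x y = ΣFin n (λ z → A x z * numWalks ℓ z y)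

  Dist : Fin n → Fin n → ℕ → Set
  Dist x y d = Walk x y d × (∀ k → k < d → ¬ Walk x y k)

  Connected : Set
  Connected = ∀ x y → ∃[ ℓ ] Walk x y ℓ

  Cubic : Set
  Cubic = ∀ x → degree x ≡ 3

  DiameterAtLeast : ℕ → Set
  DiameterAtLeast t = ∃[ x ] ∃[ y ] ∃[ d ] (Dist x y d × t ≤ d)

  WalkRegular : ℕ → Set
  WalkRegular t =
    DiameterAtLeast t ×
    (∀ d x y x' y' → d ≤ t → Dist x y d → Dist x' y' d →
       ∀ ℓ → numWalks ℓ x y ≡ numWalks ℓ x' y')

-- Let x, y be at distance 2, m a common neighbour and w the third neighbour of m.
-- Splitting walks of length ℓ + 1 from m by their first step gives
-- N_{ℓ+1}(m, b) = N_ℓ(x, b) + N_ℓ(y, b) + N_ℓ(w, b). As mx, my, mw are edges,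
-- 1-walk-regularity makes these three numbers equal for b = y, w, x; with the
-- constant diagonal N_ℓ(v, v) and the symmetry of N_ℓ this forces
-- N_ℓ(x, w) = N_ℓ(x, y) and then N_{ℓ+1}(m, y) = N_ℓ(x, x) + 2 N_ℓ(x, y).
-- Neither N_{ℓ+1}(m, y) (an edge) nor N_ℓ(x, x) depends on the pair, so neither
-- does N_ℓ(x, y).
module Submission where

open import Defs
open import Data.Bool using (true; false; if_then_else_)
open import Data.Empty using (⊥-elim)
open import Data.Fin using (Fin; zero; suc)
open import Data.Fin.Properties using (_≟_)
open import Data.Nat using (ℕ; zero; suc; _+_; _*_; _≤_; z≤n; s≤s)
open import Data.Nat.Properties
  using (+-identityʳ; +-assoc; +-comm; *-identityʳ; *-assoc; *-comm;
         *-distribʳ-+; +-cancelˡ-≡; +-cancelʳ-≡; *-cancelˡ-≡;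
         m+n≡0⇒m≡0; m+n≡0⇒n≡0; suc-injective; 0≢1+n; ≤-refl;
         +-commutativeSemigroup; +-*-semiring)
open import Algebra.Properties.CommutativeSemigroup +-commutativeSemigroup
  using (xy∙z≈xz∙y)
open import Algebra.Properties.Semiring.Sum +-*-semiring
  using (sum; sum-cong-≗; sum-replicate-zero; ∑-distrib-+; ∑-comm;
         *-distribˡ-sum; *-distribʳ-sum)
open import Data.Product using (∃-syntax; _×_; _,_; proj₁; proj₂)
open import Function using (_∘_)
open import Relation.Nullary using (¬_; does; yes; no)
open import Relation.Binary.PropositionalEquality
open ≡-Reasoning

δ : ∀ {n} → Fin n → Fin n → ℕ
δ a b = if does (a ≟ b) then 1 else 0

δ-refl : ∀ {n} (a : Fin n) → δ a a ≡ 1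
δ-refl a with a ≟ a
... | yes _  = refl
... | no a≢a = ⊥-elim (a≢a refl)

δ-≢ : ∀ {n} {a b : Fin n} → ¬ a ≡ b → δ a b ≡ 0
δ-≢ {a = a} {b} a≢b with a ≟ b
... | yes a≡b = ⊥-elim (a≢b a≡b)
... | no _    = refl

δ-sym : ∀ {n} (a b : Fin n) → δ a b ≡ δ b a
δ-sym a b with a ≟ b | b ≟ a
... | yes _   | yes _   = refl
... | no _    | no _    = refl
... | yes a≡b | no b≢a  = ⊥-elim (b≢a (sym a≡b))
... | no a≢b  | yes b≡a = ⊥-elim (a≢b (sym b≡a))

ΣFin≡sum : ∀ n (f : Fin n → ℕ) → ΣFin n f ≡ sum f
ΣFin≡sum zero    f = refl
ΣFin≡sum (suc n) f = cong (f zero +_) (ΣFin≡sum n (f ∘ suc))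

sum-δ : ∀ {n} (a : Fin n) (g : Fin n → ℕ) → sum (λ z → δ z a * g z) ≡ g a
sum-δ {suc n} zero    g = begin
  g zero + 0 + sum {n} (λ _ → 0) ≡⟨ cong₂ _+_ (+-identityʳ (g zero)) (sum-replicate-zero n) ⟩
  g zero + 0                     ≡⟨ +-identityʳ (g zero) ⟩
  g zero                         ∎
sum-δ {suc n} (suc a) g = sum-δ a (g ∘ suc)

sum-δ-+-δ-+-δ : ∀ {n} {f : Fin n → ℕ} {x y w : Fin n} →
                (∀ z → f z ≡ δ z x + δ z y + δ z w) →
                ∀ g → sum (λ z → f z * g z) ≡ g x + g y + g w
sum-δ-+-δ-+-δ {f = f} {x} {y} {w} f≗ g = begin
  sum (λ z → f z * g z)
    ≡⟨ sum-cong-≗ (λ z → trans (cong (_* g z) (f≗ z)) (distrib z)) ⟩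
  sum (λ z → δ z x * g z + δ z y * g z + δ z w * g z)
    ≡⟨ ∑-distrib-+ (λ z → δ z x * g z + δ z y * g z) (λ z → δ z w * g z) ⟩
  sum (λ z → δ z x * g z + δ z y * g z) + sum (λ z → δ z w * g z)
    ≡⟨ cong (_+ _) (∑-distrib-+ (λ z → δ z x * g z) (λ z → δ z y * g z)) ⟩
  sum (λ z → δ z x * g z) + sum (λ z → δ z y * g z) + sum (λ z → δ z w * g z)
    ≡⟨ cong₂ _+_ (cong₂ _+_ (sum-δ x g) (sum-δ y g)) (sum-δ w g) ⟩
  g x + g y + g w ∎
  where
  distrib : ∀ z → (δ z x + δ z y + δ z w) * g z ≡ δ z x * g z + δ z y * g z + δ z w * g z
  distrib z = trans (*-distribʳ-+ (g z) (δ z x + δ z y) (δ z w))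
                    (cong (_+ δ z w * g z) (*-distribʳ-+ (g z) (δ z x) (δ z y)))

sum≡0⇒≡0 : ∀ {n} (h : Fin n → ℕ) → sum h ≡ 0 → ∀ z → h z ≡ 0
sum≡0⇒≡0 h Σh≡0 zero    = m+n≡0⇒m≡0 (h zero) Σh≡0
sum≡0⇒≡0 h Σh≡0 (suc z) = sum≡0⇒≡0 (h ∘ suc) (m+n≡0⇒n≡0 (h zero) Σh≡0) z

sum≡1⇒δ : ∀ {n} (h : Fin n → ℕ) → sum h ≡ 1 → ∃[ w ] (∀ z → h z ≡ δ z w)
sum≡1⇒δ {suc n} h Σh≡1 with h zero in h₀
... | 0 with sum≡1⇒δ (h ∘ suc) Σh≡1
...   | w , h∘suc≗δ = suc w , λ { zero → h₀ ; (suc z) → h∘suc≗δ z }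
sum≡1⇒δ {suc n} h Σh≡1 | 1 =
  zero , λ { zero → h₀ ; (suc z) → sum≡0⇒≡0 (h ∘ suc) (suc-injective Σh≡1) z }

sum≡3⇒third-point : ∀ {n} (f : Fin n → ℕ) {x y : Fin n} → ¬ x ≡ y →
                    f x ≡ 1 → f y ≡ 1 → sum f ≡ 3 →
                    ∃[ w ] (∀ z → f z ≡ δ z x + δ z y + δ z w)
sum≡3⇒third-point {n} f {x} {y} x≢y fx≡1 fy≡1 Σf≡3 =
  w , λ z → trans (f≗ z) (cong (δ z x + δ z y +_) (h≗δ z))
  where
  h : Fin n → ℕ
  h z = if does (z ≟ x) then 0 else if does (z ≟ y) then 0 else f z

  f≗ : ∀ z → f z ≡ δ z x + δ z y + h z
  f≗ z with z ≟ x | z ≟ y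
  ... | yes refl | yes x≡y = ⊥-elim (x≢y x≡y)
  ... | yes refl | no _    = fx≡1
  ... | no _     | yes refl = fy≡1
  ... | no _     | no _    = refl

  sum-δ-1 : ∀ a → sum (λ z → δ z a) ≡ 1
  sum-δ-1 a = trans (sum-cong-≗ (λ z → sym (*-identityʳ (δ z a)))) (sum-δ a (λ _ → 1))

  Σh≡1 : sum h ≡ 1
  Σh≡1 = +-cancelˡ-≡ 2 _ _ (begin
    2 + sum h
      ≡⟨ cong (_+ sum h) (cong₂ _+_ (sum-δ-1 x) (sum-δ-1 y)) ⟨
    sum (λ z → δ z x) + sum (λ z → δ z y) + sum h
      ≡⟨ cong (_+ sum h) (∑-distrib-+ (λ z → δ z x) (λ z → δ z y)) ⟨
    sum (λ z → δ z x + δ z y) + sum h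
      ≡⟨ ∑-distrib-+ (λ z → δ z x + δ z y) h ⟨
    sum (λ z → δ z x + δ z y + h z)
      ≡⟨ sum-cong-≗ f≗ ⟨
    sum f
      ≡⟨ Σf≡3 ⟩
    3 ∎)

  w : Fin n
  w = proj₁ (sum≡1⇒δ h Σh≡1)

  h≗δ : ∀ z → h z ≡ δ z w
  h≗δ = proj₂ (sum≡1⇒δ h Σh≡1)

module _ (G : Graph) where
  open Graph G renaming (sym to adj-sym)

  private
    N : ℕ → Fin n → Fin n → ℕ
    N = numWalks G

  A-sym : ∀ x y → A G x y ≡ A G y x
  A-sym x y rewrite adj-sym x y = refl

  adj⇒A≡1 : ∀ {x y} → adj x y ≡ true → A G x y ≡ 1
  adj⇒A≡1 xy rewrite xy = refl

  A≢0⇒adj : ∀ {x y} → ¬ A G x y ≡ 0 → adj x y ≡ true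
  A≢0⇒adj {x} {y} A≢0 with adj x y
  ... | true  = refl
  ... | false = ⊥-elim (A≢0 refl)

  numWalks-sucˡ : ∀ ℓ x y → N (suc ℓ) x y ≡ sum (λ z → A G x z * N ℓ z y)
  numWalks-sucˡ ℓ x y = ΣFin≡sum n (λ z → A G x z * N ℓ z y)

  numWalks-sucʳ : ∀ ℓ x y → N (suc ℓ) x y ≡ sum (λ z → N ℓ x z * A G z y)
  numWalks-sucʳ zero x y = begin
    N 1 x y                            ≡⟨ numWalks-sucˡ 0 x y ⟩
    sum (λ z → A G x z * δ z y)        ≡⟨ sum-cong-≗ (λ z → *-comm (A G x z) (δ z y)) ⟩
    sum (λ z → δ z y * A G x z)        ≡⟨ sum-δ y (A G x) ⟩
    A G x y                            ≡⟨ sum-δ x (λ z → A G z y) ⟨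
    sum (λ z → δ z x * A G z y)        ≡⟨ sum-cong-≗ (λ z → cong (_* A G z y) (δ-sym z x)) ⟩
    sum (λ z → δ x z * A G z y)        ∎
  numWalks-sucʳ (suc ℓ) x y = begin
    N (suc (suc ℓ)) x y
      ≡⟨ numWalks-sucˡ (suc ℓ) x y ⟩
    sum (λ z → A G x z * N (suc ℓ) z y)
      ≡⟨ sum-cong-≗ (λ z → cong (A G x z *_) (numWalks-sucʳ ℓ z y)) ⟩
    sum (λ z → A G x z * sum (λ u → N ℓ z u * A G u y))
      ≡⟨ sum-cong-≗ (λ z → *-distribˡ-sum (A G x z) (λ u → N ℓ z u * A G u y)) ⟩
    sum (λ z → sum (λ u → A G x z * (N ℓ z u * A G u y)))
      ≡⟨ ∑-comm (λ z u → A G x z * (N ℓ z u * A G u y)) ⟩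
    sum (λ u → sum (λ z → A G x z * (N ℓ z u * A G u y)))
      ≡⟨ sum-cong-≗ (λ u → sum-cong-≗ (λ z → *-assoc (A G x z) (N ℓ z u) (A G u y))) ⟨
    sum (λ u → sum (λ z → A G x z * N ℓ z u * A G u y))
      ≡⟨ sum-cong-≗ (λ u → *-distribʳ-sum (A G u y) (λ z → A G x z * N ℓ z u)) ⟨
    sum (λ u → sum (λ z → A G x z * N ℓ z u) * A G u y)
      ≡⟨ sum-cong-≗ (λ u → cong (_* A G u y) (numWalks-sucˡ ℓ x u)) ⟨
    sum (λ u → N (suc ℓ) x u * A G u y) ∎

  numWalks-sym : ∀ ℓ x y → N ℓ x y ≡ N ℓ y x
  numWalks-sym zero    x y = δ-sym x y
  numWalks-sym (suc ℓ) x y = begin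
    N (suc ℓ) x y                      ≡⟨ numWalks-sucˡ ℓ x y ⟩
    sum (λ z → A G x z * N ℓ z y)      ≡⟨ sum-cong-≗ (λ z → cong₂ _*_ (A-sym x z) (numWalks-sym ℓ z y)) ⟩
    sum (λ z → A G z x * N ℓ y z)      ≡⟨ sum-cong-≗ (λ z → *-comm (A G z x) (N ℓ y z)) ⟩
    sum (λ z → N ℓ y z * A G z x)      ≡⟨ numWalks-sucʳ ℓ y x ⟨
    N (suc ℓ) y x                      ∎

  third-neighbour : ∀ {m x y} → degree G m ≡ 3 → adj m x ≡ true → adj m y ≡ true → ¬ x ≡ y →
                    ∃[ w ] (adj m w ≡ true × (∀ z → A G m z ≡ δ z x + δ z y + δ z w))
  third-neighbour {m} {x} {y} deg mx my x≢y with
    sum≡3⇒third-point (A G m) x≢y (adj⇒A≡1 mx) (adj⇒A≡1 my) (trans (sym (ΣFin≡sum n (A G m))) deg)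
  ... | w , Am≗ = w , A≢0⇒adj Amw≢0 , Am≗
    where
    Amw≢0 : ¬ A G m w ≡ 0
    Amw≢0 Amw≡0 = 0≢1+n (begin
      0                           ≡⟨ Amw≡0 ⟨
      A G m w                     ≡⟨ Am≗ w ⟩
      δ w x + δ w y + δ w w       ≡⟨ cong (δ w x + δ w y +_) (δ-refl w) ⟩
      δ w x + δ w y + 1           ≡⟨ +-comm _ 1 ⟩
      suc (δ w x + δ w y)         ∎)

  numWalks-via-neighbours : ∀ {m x y w} → (∀ z → A G m z ≡ δ z x + δ z y + δ z w) →
                            ∀ ℓ b → N (suc ℓ) m b ≡ N ℓ x b + N ℓ y b + N ℓ w b
  numWalks-via-neighbours {m} Am≗ ℓ b =
    trans (numWalks-sucˡ ℓ m b) (sum-δ-+-δ-+-δ Am≗ (λ z → N ℓ z b))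

  dist-refl : ∀ v → Dist G v v 0
  dist-refl v = [] , λ _ ()

  adj⇒¬walk-0 : ∀ {x y} → adj x y ≡ true → ¬ Walk G x y 0
  adj⇒¬walk-0 {x} xx [] with trans (sym xx) (irrefl x)
  ... | ()

  adj⇒dist-1 : ∀ {x y} → adj x y ≡ true → Dist G x y 1
  adj⇒dist-1 xy = xy ∷ [] , λ { zero _ → adj⇒¬walk-0 xy ; (suc _) (s≤s ()) }

  dist-2⇒≢ : ∀ {x y} → Dist G x y 2 → ¬ x ≡ y
  dist-2⇒≢ (_ , shortest) refl = shortest 0 (s≤s z≤n) []

  module _ (wr₁ : WalkRegular G 1) where

    numWalks-diagonal : ∀ ℓ u v → N ℓ u u ≡ N ℓ v v
    numWalks-diagonal ℓ u v = proj₂ wr₁ 0 u u v v z≤n (dist-refl u) (dist-refl v) ℓ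

    numWalks-edge : ∀ ℓ {x y x' y'} → adj x y ≡ true → adj x' y' ≡ true → N ℓ x y ≡ N ℓ x' y'
    numWalks-edge ℓ xy x'y' = proj₂ wr₁ 1 _ _ _ _ ≤-refl (adj⇒dist-1 xy) (adj⇒dist-1 x'y') ℓ

    numWalks-via-common-neighbour : Cubic G → ∀ ℓ {m x y} →
                                    adj m x ≡ true → adj m y ≡ true → ¬ x ≡ y →
                                    N (suc ℓ) m y ≡ N ℓ x x + 2 * N ℓ x y
    numWalks-via-common-neighbour cubic ℓ {m} {x} {y} mx my x≢y
      with third-neighbour (cubic m) mx my x≢y
    ... | w , mw , Am≗ = begin
      N (suc ℓ) m y                     ≡⟨ numWalks-edge (suc ℓ) my mx ⟩
      N (suc ℓ) m x                     ≡⟨ split x ⟩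
      N ℓ x x + N ℓ y x + N ℓ w x       ≡⟨ cong₂ (λ s t → N ℓ x x + s + t) (numWalks-sym ℓ y x)
                                                 (trans (numWalks-sym ℓ w x) (sym xy≡xw)) ⟩
      N ℓ x x + N ℓ x y + N ℓ x y       ≡⟨ +-assoc (N ℓ x x) _ _ ⟩
      N ℓ x x + (N ℓ x y + N ℓ x y)     ≡⟨ cong (λ t → N ℓ x x + (N ℓ x y + t)) (+-identityʳ _) ⟨
      N ℓ x x + 2 * N ℓ x y             ∎
      where
      split : ∀ b → N (suc ℓ) m b ≡ N ℓ x b + N ℓ y b + N ℓ w b
      split = numWalks-via-neighbours Am≗ ℓ

      xy≡xw : N ℓ x y ≡ N ℓ x w
      xy≡xw = +-cancelʳ-≡ (N ℓ x x) _ _ (+-cancelʳ-≡ (N ℓ w y) _ _ (begin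
        N ℓ x y + N ℓ x x + N ℓ w y     ≡⟨ cong (λ t → N ℓ x y + t + N ℓ w y) (numWalks-diagonal ℓ x y) ⟩
        N ℓ x y + N ℓ y y + N ℓ w y     ≡⟨ split y ⟨
        N (suc ℓ) m y                   ≡⟨ numWalks-edge (suc ℓ) my mw ⟩
        N (suc ℓ) m w                   ≡⟨ split w ⟩
        N ℓ x w + N ℓ y w + N ℓ w w     ≡⟨ cong₂ (λ s t → N ℓ x w + s + t) (numWalks-sym ℓ y w)
                                                 (numWalks-diagonal ℓ w x) ⟩
        N ℓ x w + N ℓ w y + N ℓ x x     ≡⟨ xy∙z≈xz∙y (N ℓ x w) _ _ ⟩
        N ℓ x w + N ℓ x x + N ℓ w y     ∎))

    numWalks-dist-2 : Cubic G → ∀ {x y x' y'} → Dist G x y 2 → Dist G x' y' 2 →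
                      ∀ ℓ → N ℓ x y ≡ N ℓ x' y'
    numWalks-dist-2 cubic {x} {y} {x'} {y'}
      xy@(_∷_ {z = m} xm (my ∷ []) , _) x'y'@(_∷_ {z = m'} x'm' (m'y' ∷ []) , _) ℓ =
      *-cancelˡ-≡ _ _ 2 (+-cancelˡ-≡ (N ℓ x x) _ _ (begin
        N ℓ x x + 2 * N ℓ x y           ≡⟨ via-middle xm my xy ⟨
        N (suc ℓ) m y                   ≡⟨ numWalks-edge (suc ℓ) my m'y' ⟩
        N (suc ℓ) m' y'                 ≡⟨ via-middle x'm' m'y' x'y' ⟩
        N ℓ x' x' + 2 * N ℓ x' y'       ≡⟨ cong (_+ 2 * N ℓ x' y') (numWalks-diagonal ℓ x' x) ⟩
        N ℓ x x + 2 * N ℓ x' y'         ∎))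
      where
      via-middle : ∀ {a c b} → adj a c ≡ true → adj c b ≡ true → Dist G a b 2 →
                   N (suc ℓ) c b ≡ N ℓ a a + 2 * N ℓ a b
      via-middle {a} {c} ac cb ab =
        numWalks-via-common-neighbour cubic ℓ (trans (adj-sym c a) ac) cb (dist-2⇒≢ ab)

proposition3p6 : (G : Graph) → Connected G → Cubic G →
    WalkRegular G 1 → DiameterAtLeast G 2 → WalkRegular G 2
proposition3p6 G _ cubic wr₁ diam = diam , regular-up-to-2
  where
  regular-up-to-2 : ∀ d x y x' y' → d ≤ 2 → Dist G x y d → Dist G x' y' d →
                    ∀ ℓ → numWalks G ℓ x y ≡ numWalks G ℓ x' y'
  regular-up-to-2 0 x y x' y' _ = proj₂ wr₁ 0 x y x' y' z≤n
  regular-up-to-2 1 x y x' y' _ = proj₂ wr₁ 1 x y x' y' ≤-refl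
  regular-up-to-2 2 _ _ _ _ _ = numWalks-dist-2 G wr₁ cubic
  regular-up-to-2 (suc (suc (suc _))) _ _ _ _ (s≤s (s≤s ()))
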